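{- If a multiplier $-\ltimes U:\mathcal W\to\mathcal V$ is strongly connection-free, then it is providently connection-free: for every presheaf $\Psi$ on $\mathcal W$, every object $(V,\varphi)$ of $\int_{\mathcal V}(\Psi\ltimes\mathbf yU)$ such that $\pi_2\circ\varphi:V\to U$ is dimensionally split is isomorphic to $\mathrm{Fr}^\Psi_U(W,\psi)$ for some $(W,\psi)\in\int_{\mathcal W}\Psi$.
   Context: $\mathcal W$ has a terminal object $\top$. A multiplier for $U\in\mathcal V$ is a functor $-\ltimes U:\mathcal W\to\mathcal V$ with an isomorphism $\top\ltimes U\cong U$; $\pi_2:W\ltimes U\to U$ is $(!_W\ltimes U)$ followed by it. A morphism $\varphi:V\to U$ is dimensionally split if $\varphi\circ\chi=\pi_2$ for some $W$ and $\chi:W\ltimes U\to V$. For $W_0\in\mathcal W$, $\mathrm{Fr}^{W_0}_U:\mathcal W/W_0\to\mathcal V/(W_0\ltimes U)$, $(W,\psi)\mapsto(W\ltimes U,\psi\ltimes U)$; the multiplier is strongly connection-free if for every $W_0$ every slice $(V,\varphi)\in\mathcal V/(W_0\ltimes U)$ with $\pi_2\circ\varphi$ dimensionally split is isomorphic to some $\mathrm{Fr}^{W_0}_U(W,\psi)$. For a presheaf $\Psi$ on $\mathcal W$, $\Psi\ltimes\mathbf yU$ is the presheaf on $\mathcal V$ with $(\Psi\ltimes\mathbf yU)(V)=\int^{W}\mathcal V(V,W\ltimes U)\times\Psi(W)$, elements written $(\psi\ltimes\mathbf yU)\circ\chi$; $\pi_2\circ\varphi$ is the image of $\varphi$ under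 $\pi_2:\Psi\ltimes\mathbf yU\to\mathbf yU$, $(\psi\ltimes\mathbf yU)\circ\chi\mapsto\pi_2\circ\chi$. $\int$ denotes the category of elements, and $\mathrm{Fr}^\Psi_U(W,\psi)=(W\ltimes U,\psi\ltimes\mathbf yU)$, where $\psi\ltimes\mathbf yU$ is the class of $(\mathrm{id},\psi)$. -}

module Defs where

open import Level using (Level; _⊔_) renaming (suc to lsuc)
open import Data.Product using (Σ; ∃; _×_; _,_; proj₁; proj₂)
open import Relation.Binary.PropositionalEquality using (_≡_)
open import Relation.Binary.Construct.Closure.Equivalence using (EqClosure)

record Category (o ℓ : Level) : Set (lsuc (o ⊔ ℓ)) where
  infixr 9 _∘_
  field
    Obj       : Set o
    _⇒_       : Obj → Obj → Set ℓ
    id        : ∀ {A} → A ⇒ A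
    _∘_       : ∀ {A B C} → B ⇒ C → A ⇒ B → A ⇒ C
    identityˡ : ∀ {A B} (f : A ⇒ B) → id ∘ f ≡ f
    identityʳ : ∀ {A B} (f : A ⇒ B) → f ∘ id ≡ f
    assoc     : ∀ {A B C D} (h : C ⇒ D) (g : B ⇒ C) (f : A ⇒ B) →
                (h ∘ g) ∘ f ≡ h ∘ (g ∘ f)

record Iso {o ℓ} (C : Category o ℓ) (A B : Category.Obj C) : Set ℓ where
  open Category C
  field
    to      : A ⇒ B
    from    : B ⇒ A
    isoˡ    : from ∘ to ≡ id
    isoʳ    : to ∘ from ≡ id

record Functor {o₁ ℓ₁ o₂ ℓ₂} (C : Category o₁ ℓ₁) (D : Category o₂ ℓ₂)
       : Set (o₁ ⊔ ℓ₁ ⊔ o₂ ⊔ ℓ₂) where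
  private
    module C = Category C
    module D = Category D
  field
    F₀       : C.Obj → D.Obj
    F₁       : ∀ {A B} → A C.⇒ B → F₀ A D.⇒ F₀ B
    identity : ∀ {A} → F₁ (C.id {A}) ≡ D.id
    homomorphism : ∀ {A B E} (g : B C.⇒ E) (f : A C.⇒ B) →
                   F₁ (g C.∘ f) ≡ F₁ g D.∘ F₁ f

record Presheaf {o ℓ} (C : Category o ℓ) (p : Level) : Set (o ⊔ ℓ ⊔ lsuc p) where
  open Category C
  field
    F₀       : Obj → Set p
    act      : ∀ {A B} → A ⇒ B → F₀ B → F₀ A
    identity : ∀ {A} (x : F₀ A) → act (id {A}) x ≡ x
    homomorphism : ∀ {A B E} (g : B ⇒ E) (f : A ⇒ B) (x : F₀ E) →
                   act (g ∘ f) x ≡ act f (act g x)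

record Terminal {o ℓ} (C : Category o ℓ) : Set (o ⊔ ℓ) where
  open Category C
  field
    ⊤        : Obj
    !        : ∀ {A} → A ⇒ ⊤
    !-unique : ∀ {A} (f : A ⇒ ⊤) → f ≡ !

record Multiplier {o₁ ℓ₁ o₂ ℓ₂} {𝒲 : Category o₁ ℓ₁} (𝒱 : Category o₂ ℓ₂)
       (T : Terminal 𝒲) (U : Category.Obj 𝒱) : Set (o₁ ⊔ ℓ₁ ⊔ o₂ ⊔ ℓ₂) where
  field
    functor : Functor 𝒲 𝒱
    unit    : Iso 𝒱 (Functor.F₀ functor (Terminal.⊤ T)) U

module MultiplierNotions
  {o₁ ℓ₁ o₂ ℓ₂} {𝒲 : Category o₁ ℓ₁} {𝒱 : Category o₂ ℓ₂}
  {T : Terminal 𝒲} {U : Category.Obj 𝒱} (M : Multiplier 𝒱 T U) where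

  private
    module 𝒲 = Category 𝒲
    module 𝒱 = Category 𝒱
    open Multiplier M
    module F = Functor functor

  _⋉U : 𝒲.Obj → 𝒱.Obj
  _⋉U = F.F₀

  ⋉U₁ : ∀ {W W'} → W 𝒲.⇒ W' → (W ⋉U) 𝒱.⇒ (W' ⋉U)
  ⋉U₁ = F.F₁

  π₂ : (W : 𝒲.Obj) → (W ⋉U) 𝒱.⇒ U
  π₂ W = Iso.to unit 𝒱.∘ ⋉U₁ (Terminal.! T {W})

  DimensionallySplit : ∀ {V} → V 𝒱.⇒ U → Set (o₁ ⊔ ℓ₂)
  DimensionallySplit {V} φ =
    Σ 𝒲.Obj λ W → Σ ((W ⋉U) 𝒱.⇒ V) λ χ → φ 𝒱.∘ χ ≡ π₂ W

  -- Fr^{W₀}_U (W , ψ) = (W ⋉ U , ψ ⋉ U), and isomorphism in the slice 𝒱/(W₀ ⋉ U):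
  -- an iso f : V ≅ W ⋉ U in 𝒱 with (ψ ⋉ U) ∘ f = φ.
  SliceIsoToFr : (W₀ : 𝒲.Obj) (V : 𝒱.Obj) (φ : V 𝒱.⇒ (W₀ ⋉U))
                 (W : 𝒲.Obj) (ψ : W 𝒲.⇒ W₀) → Set ℓ₂
  SliceIsoToFr W₀ V φ W ψ =
    Σ (Iso 𝒱 V (W ⋉U)) λ f → ⋉U₁ ψ 𝒱.∘ Iso.to f ≡ φ

  StronglyConnectionFree : Set (o₁ ⊔ ℓ₁ ⊔ o₂ ⊔ ℓ₂)
  StronglyConnectionFree =
    ∀ (W₀ : 𝒲.Obj) (V : 𝒱.Obj) (φ : V 𝒱.⇒ (W₀ ⋉U)) →
    DimensionallySplit (π₂ W₀ 𝒱.∘ φ) →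
    Σ 𝒲.Obj λ W → Σ (W 𝒲.⇒ W₀) λ ψ → SliceIsoToFr W₀ V φ W ψ

  module _ {p} (Ψ : Presheaf 𝒲 p) where
    private module Ψ = Presheaf Ψ

    -- Representatives of elements of (Ψ ⋉ yU)(V) = ∫^W 𝒱(V, W ⋉ U) × Ψ(W):
    -- a triple (W , χ , ψ) standing for (ψ ⋉ yU) ∘ χ.
    Rep : 𝒱.Obj → Set (o₁ ⊔ ℓ₂ ⊔ p)
    Rep V = Σ 𝒲.Obj λ W → (V 𝒱.⇒ (W ⋉U)) × Ψ.F₀ W

    -- Generating relation of the coend:  (W , χ , Ψ(g) ψ') ~ (W' , (g ⋉ U) ∘ χ , ψ').
    data CoendStep {V : 𝒱.Obj} : Rep V → Rep V → Set (o₁ ⊔ ℓ₁ ⊔ ℓ₂ ⊔ p) where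
      step : ∀ {W W'} (g : W 𝒲.⇒ W') (χ : V 𝒱.⇒ (W ⋉U)) (ψ' : Ψ.F₀ W') →
             CoendStep (W , χ , Ψ.act g ψ') (W' , ⋉U₁ g 𝒱.∘ χ , ψ')

    _≈E_ : ∀ {V} → Rep V → Rep V → Set (o₁ ⊔ ℓ₁ ⊔ ℓ₂ ⊔ p)
    _≈E_ = EqClosure CoendStep

    restrict : ∀ {V V'} → Rep V' → V 𝒱.⇒ V' → Rep V
    restrict (W , χ , ψ) f = (W , χ 𝒱.∘ f , ψ)

    -- π₂ ∘ φ  (the image of φ under π₂ : Ψ ⋉ yU → yU)
    π₂∘ : ∀ {V} → Rep V → V 𝒱.⇒ U
    π₂∘ (W , χ , ψ) = π₂ W 𝒱.∘ χ

    ElObj : Set (o₁ ⊔ o₂ ⊔ ℓ₂ ⊔ p)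
    ElObj = Σ 𝒱.Obj Rep

    -- Isomorphisms in ∫_𝒱 (Ψ ⋉ yU): mutually inverse morphisms of 𝒱,
    -- each a morphism of the category of elements.
    record ElIso (X Y : ElObj) : Set (o₁ ⊔ ℓ₁ ⊔ ℓ₂ ⊔ p) where
      field
        iso     : Iso 𝒱 (proj₁ X) (proj₁ Y)
        to-el   : restrict (proj₂ Y) (Iso.to iso) ≈E proj₂ X
        from-el : restrict (proj₂ X) (Iso.from iso) ≈E proj₂ Y

    -- Fr^Ψ_U (W , ψ) = (W ⋉ U , ψ ⋉ yU), with ψ ⋉ yU the class of (id , ψ).
    Fr : (W : 𝒲.Obj) → Ψ.F₀ W → ElObj
    Fr W ψ = (W ⋉U , (W , 𝒱.id , ψ))

  ProvidentlyConnectionFree : ∀ p → Set (o₁ ⊔ ℓ₁ ⊔ o₂ ⊔ ℓ₂ ⊔ lsuc p)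
  ProvidentlyConnectionFree p =
    ∀ (Ψ : Presheaf 𝒲 p) (V : 𝒱.Obj) (φ : Rep Ψ V) →
    DimensionallySplit (π₂∘ Ψ φ) →
    Σ 𝒲.Obj λ W → Σ (Presheaf.F₀ Ψ W) λ ψ → ElIso Ψ (V , φ) (Fr Ψ W ψ)

module Submission where

-- An element of Ψ ⋉ yU over V is represented by some (ψ₀ ⋉ yU) ∘ χ with χ : V → W₀ ⋉ U,
-- and then π₂ ∘ φ = π₂ ∘ χ.  Strong connection-freeness applied to the slice (V , χ) over
-- W₀ ⋉ U gives an iso f : V ≅ W ⋉ U and g : W → W₀ with (g ⋉ U) ∘ f = χ; the coend
-- relation identifies (ψ₀ ⋉ yU) ∘ (g ⋉ U) ∘ f with (Ψ(g) ψ₀ ⋉ yU) ∘ f, so f is an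
-- isomorphism onto Fr(W , Ψ(g) ψ₀) in the category of elements.

open import Defs
open import Level using (Level)
open import Data.Product using (_,_)
open import Relation.Binary.PropositionalEquality using (_≡_; cong; subst; module ≡-Reasoning)
open import Relation.Binary.Construct.Closure.Equivalence using (return; symmetric)

module _ {o₁ ℓ₁ o₂ ℓ₂} {𝒲 : Category o₁ ℓ₁} {𝒱 : Category o₂ ℓ₂}
         {T : Terminal 𝒲} {U : Category.Obj 𝒱} (M : Multiplier 𝒱 T U)
         {p} (Ψ : Presheaf 𝒲 p) where

  open MultiplierNotions M
  private
    module 𝒲 = Category 𝒲
    module 𝒱 = Category 𝒱
    module Ψ = Presheaf Ψ

  coendStep-≈ : ∀ {V W W'} (g : W 𝒲.⇒ W') {χ : V 𝒱.⇒ (W ⋉U)} {χ' : V 𝒱.⇒ (W' ⋉U)} →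
                ⋉U₁ g 𝒱.∘ χ ≡ χ' → (ψ' : Ψ.F₀ W') →
                _≈E_ Ψ (W , χ , Ψ.act g ψ') (W' , χ' , ψ')
  coendStep-≈ {W = W} {W'} g {χ} eq ψ' =
    subst (λ χ' → _≈E_ Ψ (W , χ , Ψ.act g ψ') (W' , χ' , ψ')) eq (return (step g χ ψ'))

  sliceIsoToFr⇒ElIso : ∀ {W₀ V W} {χ : V 𝒱.⇒ (W₀ ⋉U)} {g : W 𝒲.⇒ W₀} (ψ₀ : Ψ.F₀ W₀) →
                       SliceIsoToFr W₀ V χ W g →
                       ElIso Ψ (V , (W₀ , χ , ψ₀)) (Fr Ψ W (Ψ.act g ψ₀))
  sliceIsoToFr⇒ElIso {χ = χ} {g} ψ₀ (f , g∘f≡χ) = record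
    { iso     = f
    ; to-el   = coendStep-≈ g g∘id∘f≡χ ψ₀
    ; from-el = symmetric _ (coendStep-≈ g g∘id≡χ∘f⁻¹ ψ₀)
    }
    where
    open ≡-Reasoning
    open Iso f

    g∘id∘f≡χ : ⋉U₁ g 𝒱.∘ (𝒱.id 𝒱.∘ to) ≡ χ
    g∘id∘f≡χ = begin
      ⋉U₁ g 𝒱.∘ (𝒱.id 𝒱.∘ to) ≡⟨ cong (⋉U₁ g 𝒱.∘_) (𝒱.identityˡ to) ⟩
      ⋉U₁ g 𝒱.∘ to            ≡⟨ g∘f≡χ ⟩
      χ                        ∎

    g∘id≡χ∘f⁻¹ : ⋉U₁ g 𝒱.∘ 𝒱.id ≡ χ 𝒱.∘ from
    g∘id≡χ∘f⁻¹ = begin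
      ⋉U₁ g 𝒱.∘ 𝒱.id             ≡˘⟨ cong (⋉U₁ g 𝒱.∘_) isoʳ ⟩
      ⋉U₁ g 𝒱.∘ (to 𝒱.∘ from)    ≡˘⟨ 𝒱.assoc (⋉U₁ g) to from ⟩
      (⋉U₁ g 𝒱.∘ to) 𝒱.∘ from    ≡⟨ cong (𝒱._∘ from) g∘f≡χ ⟩
      χ 𝒱.∘ from                  ∎

mainTheorem15 : ∀ {o₁ ℓ₁ o₂ ℓ₂ : Level} {𝒲 : Category o₁ ℓ₁} {𝒱 : Category o₂ ℓ₂}
    (T : Terminal 𝒲) (U : Category.Obj 𝒱) (M : Multiplier 𝒱 T U) →
    MultiplierNotions.StronglyConnectionFree M →
    ∀ (p : Level) → MultiplierNotions.ProvidentlyConnectionFree M p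
mainTheorem15 T U M strongly p Ψ V (W₀ , χ , ψ₀) split
  with strongly W₀ V χ split
... | W , g , sliceIso = W , Presheaf.act Ψ g ψ₀ , sliceIsoToFr⇒ElIso M Ψ ψ₀ sliceIso
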